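{- Let $V$ be a $2r$-dimensional vector space over $\mathbb{F}_2$ with a nondegenerate quadratic form $Q$ and associated bilinear form $B$. Let $W$ be a nontrivial subspace of $V$ of dimension $m\equiv 2\pmod 4$ such that $W$ has a symmetric basis (with respect to the restriction of $Q$). Suppose $\{a,b\},\{c,d\},\{g,h\}$ are three hyperbolic pairs contained in $W^{\perp}\setminus W$ which are pairwise perpendicular (i.e. $\langle a,b\rangle,\langle c,d\rangle,\langle g,h\rangle$ are mutually orthogonal). Let $W'=W\perp\langle a,b\rangle\perp\langle c,d\rangle\perp\langle g,h\rangle$. Then $W'$ has a symmetric basis.
   Context: The associated bilinear form is $B(u,v)=Q(u+v)-Q(u)-Q(v)$. A basis $\{v_1,\ldots,v_d\}$ is symmetric if $Q(v_i)=0$ for all $i$ and $B(v_i,v_j)=1$ for all $i<j$. A hyperbolic pair is a pair of distinct vectors $u,v$ with $Q(u)=Q(v)=0$ and $B(u,v)=1$. $W^\perp=\{v\in V: B(w,v)=0\ \forall w\in W\}$, and $\perp$ denotes an orthogonal direct sum. -}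

module Defs where

open import Data.Nat using (ℕ; zero; suc; _*_)
open import Data.Bool using (Bool; true; false; _xor_; if_then_else_)
open import Data.Fin using (Fin; _<_)
import Data.Fin as Fin
open import Data.Vec using (Vec; replicate; zipWith; lookup; _∷_; [])
open import Data.Product using (Σ; _×_; ∃)
open import Relation.Binary.PropositionalEquality using (_≡_)
open import Relation.Nullary using (¬_)
open import Function.Bundles using (_⇔_)

V : ℕ → Set
V n = Vec Bool n

𝟎 : ∀ {n} → V n
𝟎 = replicate _ false

infixl 6 _⊕_
_⊕_ : ∀ {n} → V n → V n → V n
_⊕_ = zipWith _xor_

_·_ : ∀ {n} → Bool → V n → V n
b · v = if b then v else 𝟎

lc : ∀ {n k} → (Fin k → V n) → (Fin k → Bool) → V n
lc {k = zero}  w c = 𝟎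
lc {k = suc k} w c = (c Fin.zero · w Fin.zero) ⊕ lc (λ i → w (Fin.suc i)) (λ i → c (Fin.suc i))

polar : ∀ {n} → (V n → Bool) → V n → V n → Bool
polar Q u v = Q (u ⊕ v) xor Q u xor Q v

-- Q is a quadratic form over F₂: Q(λv) = λ²Q(v) (i.e. Q(0) = 0) and B is bilinear
record IsQuadraticForm {n} (Q : V n → Bool) : Set where
  field
    Q-zero   : Q 𝟎 ≡ false
    B-additiveˡ : ∀ u u′ v → polar Q (u ⊕ u′) v ≡ polar Q u v xor polar Q u′ v

Nondegenerate : ∀ {n} → (V n → Bool) → Set
Nondegenerate Q = ∀ v → (∀ u → polar Q u v ≡ false) → v ≡ 𝟎

record IsSubspace {n} (W : V n → Set) : Set where
  field
    has-zero : W 𝟎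
    closed-+ : ∀ {u v} → W u → W v → W (u ⊕ v)

Nontrivial : ∀ {n} → (V n → Set) → Set
Nontrivial W = ∃ λ v → W v × ¬ (v ≡ 𝟎)

LinearlyIndependent : ∀ {n k} → (Fin k → V n) → Set
LinearlyIndependent w = ∀ c → lc w c ≡ 𝟎 → ∀ i → c i ≡ false

Spans : ∀ {n k} → (Fin k → V n) → (V n → Set) → Set
Spans w W = ∀ x → W x ⇔ (∃ λ c → lc w c ≡ x)

IsBasis : ∀ {n k} → (V n → Set) → (Fin k → V n) → Set
IsBasis W w = LinearlyIndependent w × Spans w W

IsSymmetricBasis : ∀ {n k} → (V n → Bool) → (V n → Set) → (Fin k → V n) → Set
IsSymmetricBasis Q W w =
  IsBasis W w × (∀ i → Q (w i) ≡ false) × (∀ i j → i < j → polar Q (w i) (w j) ≡ true)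

HasSymmetricBasis : ∀ {n} → (V n → Bool) → (V n → Set) → Set
HasSymmetricBasis Q W = Σ ℕ λ k → Σ (Fin k → V _) λ w → IsSymmetricBasis Q W w

HasDimension : ∀ {n} → (V n → Set) → ℕ → Set
HasDimension W m = Σ (Fin m → V _) λ w → IsBasis W w

HyperbolicPair : ∀ {n} → (V n → Bool) → V n → V n → Set
HyperbolicPair Q u v = ¬ (u ≡ v) × Q u ≡ false × Q v ≡ false × polar Q u v ≡ true

InPerp : ∀ {n} → (V n → Bool) → (V n → Set) → V n → Set
InPerp Q W v = ∀ w → W w → polar Q w v ≡ false

-- ⟨u,v⟩ ⟂ ⟨x,y⟩ (equivalent by bilinearity to orthogonality of generators)
PairsPerp : ∀ {n} → (V n → Bool) → V n → V n → V n → V n → Set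
PairsPerp Q u v x y =
  polar Q u x ≡ false × polar Q u y ≡ false × polar Q v x ≡ false × polar Q v y ≡ false

Extend3 : ∀ {n} → (V n → Set) → (a b c d g h : V n) → V n → Set
Extend3 W a b c d g h x =
  ∃ λ y → W y × ∃ λ (s : Fin 6 → Bool) →
    x ≡ y ⊕ lc (lookup (a ∷ b ∷ c ∷ d ∷ g ∷ h ∷ [])) s

module Submission where

-- Let v₁, …, v_k be a symmetric basis of W and s = v₁ + ⋯ + v_k. Counting |W| = 2 ^ k
-- shows k = m ≡ 2 (mod 4), hence Q(s) = (k choose 2) = 1 and B(vᵢ, s) = k − 1 = 1.
-- The span of a, …, h has a basis y₁, …, y₆ with Q(yⱼ) = 1 and B(yᵢ, yⱼ) = 1 for i ≠ j,
-- and it is orthogonal to W. So s + y₁, …, s + y₆, v₁, …, v_k are isotropic, pairwise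
-- nonorthogonal, and span W′. A pairwise nonorthogonal family of even size is linearly
-- independent, because its Gram matrix J + I is then an involution.

open import Defs
open import Algebra.Bundles using (CommutativeMonoid; CommutativeRing)
open import Algebra.Structures using (IsCommutativeMonoid)
open import Data.Bool using (Bool; true; false; _xor_; _∧_; not)
open import Data.Bool.Properties
  using (xor-assoc; xor-comm; xor-same; xor-identityʳ; ∧-zeroʳ; ∧-identityʳ; not-injective; xor-∧-commutativeRing)
  renaming (_≟_ to _≟ᵇ_)
open import Data.Fin using (Fin; zero; suc; _<_; _↑ˡ_; _↑ʳ_; splitAt)
open import Data.Fin.Patterns using (0F; 1F; 2F; 3F; 4F; 5F)
open import Data.Fin.Properties
  using (_≟_; all?; <-cmp; <⇒≢; punchInᵢ≢i; splitAt⁻¹-↑ˡ; splitAt⁻¹-↑ʳ; finToFun-funToFin; funToFin-finToFin; injective⇒≤; 2↔Bool)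
open import Data.Fin.Base using (funToFin; finToFun; punchIn; combine)
open import Data.Nat using (ℕ; zero; suc; _+_; _*_; _%_; _/_; _^_; _≤_; s≤s; z≤n)
open import Data.Nat.Divisibility using (_∣_; divides; ∣m∣n⇒∣m+n; ∣-trans; n∣m*n)
open import Data.Nat.DivMod using (m≡m%n+[m/n]*n)
import Data.Nat.Properties as ℕ
open import Data.Product using (_×_; _,_; proj₁; proj₂; ∃)
open import Data.Sum using (inj₁; inj₂)
open import Data.Vec using (Vec; _∷_; []; lookup)
open import Data.Vec.Functional using (_++_)
open import Data.Vec.Functional.Properties using (lookup-++ˡ; lookup-++ʳ)
open import Data.Vec.Functional.Relation.Unary.All.Properties using (++⁺)
open import Data.Vec.Properties using (zipWith-assoc; zipWith-comm; zipWith-identityˡ; zipWith-identityʳ)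
open import Function using (_∘_; _⇔_; Inverse; Equivalence; mk⇔)
import Function.Properties.Equivalence as ⇔
import Algebra.Properties.CommutativeSemigroup
open import Level using (0ℓ)
open import Relation.Binary using (tri<; tri≈; tri>)
open import Relation.Binary.PropositionalEquality
open import Relation.Nullary using (¬_; ¬?; does; contradiction)
open import Relation.Nullary.Decidable using (from-yes; _→-dec_)

open CommutativeRing xor-∧-commutativeRing using (+-commutativeMonoid)
open import Algebra.Properties.CommutativeMonoid.Sum +-commutativeMonoid
  using (sum; sum-cong-≗; sum-remove; sum-replicate; sum-replicate-zero)
open import Algebra.Properties.Monoid.Mult (CommutativeMonoid.monoid +-commutativeMonoid)
  using () renaming (_×_ to _times_)

xor-cancel : ∀ p x → p xor (x xor p) ≡ x
xor-cancel false x     = xor-identityʳ x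
xor-cancel true  false = refl
xor-cancel true  true  = refl

xor≡false⇒≡ : ∀ {x y} → x xor y ≡ false → x ≡ y
xor≡false⇒≡ {false} {false} _ = refl
xor≡false⇒≡ {true}  {true}  _ = refl

times-even : ∀ {n} b → 2 ∣ n → n times b ≡ false
times-even b (divides zero refl) = refl
times-even b (divides (suc q) refl) = begin
  b xor (b xor (q * 2) times b) ≡⟨ xor-assoc b b _ ⟨
  (b xor b) xor (q * 2) times b ≡⟨ cong (_xor (q * 2) times b) (xor-same b) ⟩
  (q * 2) times b               ≡⟨ times-even b (divides q refl) ⟩
  false                         ∎
  where open ≡-Reasoning

sum-false : ∀ {k} {f : Fin k → Bool} → (∀ i → f i ≡ false) → sum f ≡ false
sum-false {k} f≡false = trans (sum-cong-≗ f≡false) (sum-replicate-zero k)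

sum-except : ∀ {k} {f c : Fin k → Bool} (j : Fin k) → f j ≡ false →
             (∀ i → i ≢ j → f i ≡ c i) → sum c ≡ c j xor sum f
sum-except {suc k} {f} {c} j fj≡false f≡c = begin
  sum c                              ≡⟨ sum-remove c ⟩
  c j xor sum (λ i → c (punchIn j i)) ≡⟨ cong (c j xor_) (sum-cong-≗ (λ i → sym (f≡c _ (punchInᵢ≢i j i)))) ⟩
  c j xor sum (λ i → f (punchIn j i)) ≡⟨ cong (λ b → c j xor (b xor sum (λ i → f (punchIn j i)))) fj≡false ⟨
  c j xor (f j xor sum (λ i → f (punchIn j i))) ≡⟨ cong (c j xor_) (sum-remove f) ⟨
  c j xor sum f                      ∎
  where open ≡-Reasoning

pairsParity : ℕ → Bool
pairsParity zero    = false
pairsParity (suc k) = pairsParity k xor k times true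

pairsParity-+4 : ∀ k → pairsParity (4 + k) ≡ pairsParity k
pairsParity-+4 k = alternating-cancel (pairsParity k) (k times true)
  where
  alternating-cancel : ∀ t p → (((t xor p) xor not p) xor not (not p)) xor not (not (not p)) ≡ t
  alternating-cancel false false = refl
  alternating-cancel false true  = refl
  alternating-cancel true  false = refl
  alternating-cancel true  true  = refl

%4≡2⇒≡2+4q : ∀ {k} → k % 4 ≡ 2 → k ≡ 2 + (k / 4) * 4
%4≡2⇒≡2+4q {k} k%4≡2 = trans (m≡m%n+[m/n]*n k 4) (cong (_+ (k / 4) * 4) k%4≡2)

%4≡2⇒even : ∀ {k} → k % 4 ≡ 2 → 2 ∣ k
%4≡2⇒even {k} k%4≡2 = subst (2 ∣_) (sym (%4≡2⇒≡2+4q {k} k%4≡2))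
  (∣m∣n⇒∣m+n (divides 1 refl) (∣-trans (divides 2 refl) (n∣m*n (k / 4))))

%4≡2⇒pairsParity : ∀ {k} → k % 4 ≡ 2 → pairsParity k ≡ true
%4≡2⇒pairsParity {k} k%4≡2 =
  subst (λ k → pairsParity k ≡ true) (sym (%4≡2⇒≡2+4q {k} k%4≡2)) (pairsParity-2+4q (k / 4))
  where
  pairsParity-2+4q : ∀ q → pairsParity (2 + q * 4) ≡ true
  pairsParity-2+4q zero    = refl
  pairsParity-2+4q (suc q) = trans (pairsParity-+4 (2 + q * 4)) (pairsParity-2+4q q)

module _ {n : ℕ} where

  ⊕-assoc : (x y z : V n) → (x ⊕ y) ⊕ z ≡ x ⊕ (y ⊕ z)
  ⊕-assoc = zipWith-assoc xor-assoc

  ⊕-comm : (x y : V n) → x ⊕ y ≡ y ⊕ x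
  ⊕-comm = zipWith-comm xor-comm

  ⊕-identityˡ : (x : V n) → 𝟎 ⊕ x ≡ x
  ⊕-identityˡ = zipWith-identityˡ (λ _ → refl)

  ⊕-identityʳ : (x : V n) → x ⊕ 𝟎 ≡ x
  ⊕-identityʳ = zipWith-identityʳ xor-identityʳ

  ⊕-isCommutativeMonoid : IsCommutativeMonoid _≡_ _⊕_ (𝟎 {n})
  ⊕-isCommutativeMonoid = record
    { isMonoid = record
      { isSemigroup = record
        { isMagma = record { isEquivalence = isEquivalence ; ∙-cong = cong₂ _⊕_ }
        ; assoc   = ⊕-assoc }
      ; identity = ⊕-identityˡ , ⊕-identityʳ }
    ; comm = ⊕-comm }

⊕-self : ∀ {n} (x : V n) → x ⊕ x ≡ 𝟎
⊕-self []       = refl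
⊕-self (b ∷ x) = cong₂ _∷_ (xor-same b) (⊕-self x)

⊕-commutativeMonoid : ℕ → CommutativeMonoid 0ℓ 0ℓ
⊕-commutativeMonoid n = record { isCommutativeMonoid = ⊕-isCommutativeMonoid {n} }

module ⊕-Properties {n : ℕ} =
  Algebra.Properties.CommutativeSemigroup (CommutativeMonoid.commutativeSemigroup (⊕-commutativeMonoid n))

module _ {n : ℕ} where

  open ⊕-Properties {n} using (interchange; xy∙z≈zx∙y)

  ·-distribˡ-⊕ : ∀ b (x y : V n) → b · (x ⊕ y) ≡ b · x ⊕ b · y
  ·-distribˡ-⊕ true  x y = refl
  ·-distribˡ-⊕ false x y = sym (⊕-identityˡ 𝟎)

  ·-distribʳ-xor : ∀ b b′ (x : V n) → (b xor b′) · x ≡ b · x ⊕ b′ · x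
  ·-distribʳ-xor true  true  x = sym (⊕-self x)
  ·-distribʳ-xor true  false x = sym (⊕-identityʳ x)
  ·-distribʳ-xor false b′    x = sym (⊕-identityˡ (b′ · x))

  ·-∧ : ∀ b b′ (x : V n) → b · (b′ · x) ≡ (b′ ∧ b) · x
  ·-∧ b true  x = refl
  ·-∧ true  false x = refl
  ·-∧ false false x = refl

  lc-congʳ : ∀ {k} (w : Fin k → V n) {c d : Fin k → Bool} → c ≗ d → lc w c ≡ lc w d
  lc-congʳ {zero}  w c≗d = refl
  lc-congʳ {suc k} w c≗d = cong₂ _⊕_ (cong (_· w zero) (c≗d zero)) (lc-congʳ (w ∘ suc) (c≗d ∘ suc))

  lc-congˡ : ∀ {k} {w u : Fin k → V n} → w ≗ u → ∀ c → lc w c ≡ lc u c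
  lc-congˡ {zero}  w≗u c = refl
  lc-congˡ {suc k} w≗u c = cong₂ _⊕_ (cong (c zero ·_) (w≗u zero)) (lc-congˡ (w≗u ∘ suc) (c ∘ suc))

  lc-false : ∀ {k} (w : Fin k → V n) → lc w (λ _ → false) ≡ 𝟎
  lc-false {zero}  w = refl
  lc-false {suc k} w = trans (⊕-identityˡ _) (lc-false (w ∘ suc))

  lc-δ : ∀ {k} (w : Fin k → V n) i → lc w (λ j → does (i ≟ j)) ≡ w i
  lc-δ {suc k} w zero    = trans (cong (w zero ⊕_) (lc-false (w ∘ suc))) (⊕-identityʳ (w zero))
  lc-δ {suc k} w (suc i) = trans (⊕-identityˡ (lc (w ∘ suc) (λ j → does (i ≟ j)))) (lc-δ (w ∘ suc) i)

  lc-⊕ : ∀ {k} (w : Fin k → V n) c d → lc w c ⊕ lc w d ≡ lc w (λ i → c i xor d i)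
  lc-⊕ {zero}  w c d = ⊕-identityˡ 𝟎
  lc-⊕ {suc k} w c d = trans (interchange _ _ _ _)
    (cong₂ _⊕_ (sym (·-distribʳ-xor (c zero) (d zero) (w zero))) (lc-⊕ (w ∘ suc) (c ∘ suc) (d ∘ suc)))

  lc-· : ∀ {k} (w : Fin k → V n) c b → b · lc w c ≡ lc w (λ i → c i ∧ b)
  lc-· {zero}  w c true  = refl
  lc-· {zero}  w c false = refl
  lc-· {suc k} w c b = trans (·-distribˡ-⊕ b _ _)
    (cong₂ _⊕_ (·-∧ b (c zero) (w zero)) (lc-· (w ∘ suc) (c ∘ suc) b))

  lc-lc : ∀ {k l} (w : Fin l → V n) (M : Fin k → Fin l → Bool) c →
          lc (λ j → lc w (M j)) c ≡ lc w (λ i → sum (λ j → M j i ∧ c j))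
  lc-lc {zero}  w M c = sym (lc-false w)
  lc-lc {suc k} w M c = trans (cong₂ _⊕_ (lc-· w (M zero) (c zero)) (lc-lc w (M ∘ suc) (c ∘ suc))) (lc-⊕ w _ _)

  lc-shift : ∀ {k} (s : V n) (y : Fin k → V n) c → lc (λ j → s ⊕ y j) c ≡ sum c · s ⊕ lc y c
  lc-shift {zero}  s y c = sym (⊕-identityˡ 𝟎)
  lc-shift {suc k} s y c = begin
    c zero · (s ⊕ y zero) ⊕ lc (λ j → s ⊕ y (suc j)) (c ∘ suc)
      ≡⟨ cong₂ _⊕_ (·-distribˡ-⊕ (c zero) s (y zero)) (lc-shift s (y ∘ suc) (c ∘ suc)) ⟩
    (c zero · s ⊕ c zero · y zero) ⊕ (sum (c ∘ suc) · s ⊕ lc (y ∘ suc) (c ∘ suc))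
      ≡⟨ interchange _ _ _ _ ⟩
    (c zero · s ⊕ sum (c ∘ suc) · s) ⊕ lc y c
      ≡⟨ cong (_⊕ lc y c) (·-distribʳ-xor (c zero) (sum (c ∘ suc)) s) ⟨
    sum c · s ⊕ lc y c ∎
    where open ≡-Reasoning

  lc-split : ∀ {l k} (w : Fin (l + k) → V n) c →
             lc w c ≡ lc (λ j → w (j ↑ˡ k)) (λ j → c (j ↑ˡ k)) ⊕ lc (λ i → w (l ↑ʳ i)) (λ i → c (l ↑ʳ i))
  lc-split {zero}  w c = sym (⊕-identityˡ _)
  lc-split {suc l} {k} w c = trans (cong (c zero · w zero ⊕_) (lc-split {l} {k} (w ∘ suc) (c ∘ suc))) (sym (⊕-assoc _ _ _))

  lc-++ : ∀ {l k} (f : Fin l → V n) (u : Fin k → V n) c →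
          lc (f ++ u) c ≡ lc f (λ j → c (j ↑ˡ k)) ⊕ lc u (λ i → c (l ↑ʳ i))
  lc-++ {l} {k} f u c = trans (lc-split {l} {k} (f ++ u) c)
    (cong₂ _⊕_ (lc-congˡ (lookup-++ˡ f u) _) (lc-congˡ (lookup-++ʳ f u) _))

spans⇒lc∈ : ∀ {n k} {W : V n → Set} {v : Fin k → V n} → Spans v W → ∀ c → W (lc v c)
spans⇒lc∈ {v = v} v-spans c = Equivalence.from (v-spans (lc v c)) (c , refl)

-- Uniqueness of dimension

independent⇒lc-injective : ∀ {n k} {v : Fin k → V n} → LinearlyIndependent v →
                           ∀ c d → lc v c ≡ lc v d → c ≗ d
independent⇒lc-injective {v = v} v-indep c d vc≡vd i = xor≡false⇒≡ (v-indep _ lc≡𝟎 i)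
  where
  lc≡𝟎 : lc v (λ i → c i xor d i) ≡ 𝟎
  lc≡𝟎 = trans (sym (lc-⊕ v c d)) (trans (cong (_⊕ lc v d) vc≡vd) (⊕-self (lc v d)))

toBools : ∀ {k} → Fin (2 ^ k) → Fin k → Bool
toBools x = Inverse.to 2↔Bool ∘ finToFun x

fromBools : ∀ {k} → (Fin k → Bool) → Fin (2 ^ k)
fromBools c = funToFin (Inverse.from 2↔Bool ∘ c)

toBools-fromBools : ∀ {k} (c : Fin k → Bool) → toBools {k} (fromBools c) ≗ c
toBools-fromBools c i =
  trans (cong (Inverse.to 2↔Bool) (finToFun-funToFin _ i)) (Inverse.strictlyInverseˡ 2↔Bool (c i))

funToFin-cong : ∀ {k m} {f g : Fin k → Fin m} → f ≗ g → funToFin f ≡ funToFin g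
funToFin-cong {zero}  f≗g = refl
funToFin-cong {suc k} f≗g = cong₂ combine (f≗g zero) (funToFin-cong (f≗g ∘ suc))

toBools-injective : ∀ {k} {x y : Fin (2 ^ k)} → toBools {k} x ≗ toBools y → x ≡ y
toBools-injective {k} {x} {y} x≗y = begin
  x                             ≡⟨ funToFin-finToFin {k} x ⟨
  funToFin (finToFun {2} {k} x) ≡⟨ funToFin-cong (Inverse.strictlyInverseʳ 2↔Bool ∘ finToFun {2} {k} x) ⟨
  fromBools (toBools {k} x)     ≡⟨ funToFin-cong (cong (Inverse.from 2↔Bool) ∘ x≗y) ⟩
  fromBools (toBools {k} y)     ≡⟨ funToFin-cong (Inverse.strictlyInverseʳ 2↔Bool ∘ finToFun {2} {k} y) ⟩
  funToFin (finToFun {2} {k} y) ≡⟨ funToFin-finToFin {k} y ⟩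
  y                             ∎
  where open ≡-Reasoning

cube-injection⇒≤ : ∀ {k m} (f : (Fin k → Bool) → Fin m → Bool) → (∀ c d → f c ≗ f d → c ≗ d) → k ≤ m
cube-injection⇒≤ {k} {m} f f-injective =
  ℕ.≮⇒≥ (λ m<k → ℕ.<⇒≱ (ℕ.^-monoʳ-< 2 (s≤s (s≤s z≤n)) m<k) (injective⇒≤ g-injective))
  where
  g : Fin (2 ^ k) → Fin (2 ^ m)
  g = fromBools ∘ f ∘ toBools {k}
  g-injective : ∀ {x y} → g x ≡ g y → x ≡ y
  g-injective {x} {y} gx≡gy = toBools-injective {k} (f-injective _ _ λ i →
    trans (sym (toBools-fromBools _ i)) (trans (cong (λ z → toBools {m} z i) gx≡gy) (toBools-fromBools _ i)))

basis-size-≤ : ∀ {n k m} {W : V n → Set} {v : Fin k → V n} {w : Fin m → V n} →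
               IsBasis W v → IsBasis W w → k ≤ m
basis-size-≤ {k = k} {m} {v = v} {w} (v-indep , v-spans) (_ , w-spans) = cube-injection⇒≤ coords coords-injective
  where
  coords-spec : ∀ c → ∃ λ d → lc w d ≡ lc v c
  coords-spec c = Equivalence.to (w-spans (lc v c)) (spans⇒lc∈ v-spans c)
  coords : (Fin k → Bool) → Fin m → Bool
  coords c = proj₁ (coords-spec c)
  coords-injective : ∀ c d → coords c ≗ coords d → c ≗ d
  coords-injective c d c≗d = independent⇒lc-injective v-indep c d
    (trans (sym (proj₂ (coords-spec c))) (trans (lc-congʳ w c≗d) (proj₂ (coords-spec d))))

basis-size-unique : ∀ {n k m} {W : V n → Set} {v : Fin k → V n} {w : Fin m → V n} →
                    IsBasis W v → IsBasis W w → k ≡ m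
basis-size-unique v-basis w-basis = ℕ.≤-antisym (basis-size-≤ v-basis w-basis) (basis-size-≤ w-basis v-basis)

-- Q (Σᵢ cᵢ wᵢ) as a polynomial in the values qᵢ = Q wᵢ and the Gram matrix Gᵢⱼ = B wᵢ wⱼ.
quadratic : ∀ {k} → (Fin k → Bool) → (Fin k → Fin k → Bool) → (Fin k → Bool) → Bool
quadratic {zero}  q G c = false
quadratic {suc k} q G c =
  c zero ∧ q zero xor quadratic (q ∘ suc) (λ i j → G (suc i) (suc j)) (c ∘ suc)
                  xor c zero ∧ sum (λ j → c (suc j) ∧ G (suc j) zero)

bilinear : ∀ {k} → (Fin k → Fin k → Bool) → (Fin k → Bool) → (Fin k → Bool) → Bool
bilinear G c d = sum (λ i → c i ∧ sum (λ j → d j ∧ G j i))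

module QuadraticForm {n} {Q : V n → Bool} (isQ : IsQuadraticForm Q) where

  open IsQuadraticForm isQ

  B : V n → V n → Bool
  B = polar Q

  Nonorthogonal : ∀ {k} → (Fin k → V n) → Set
  Nonorthogonal w = ∀ i j → i ≢ j → B (w i) (w j) ≡ true

  Q-⊕ : ∀ u v → Q (u ⊕ v) ≡ Q u xor Q v xor B u v
  Q-⊕ u v = sym (trans (sym (xor-assoc (Q u) (Q v) (B u v))) (xor-cancel (Q u xor Q v) (Q (u ⊕ v))))

  Q-· : ∀ b v → Q (b · v) ≡ b ∧ Q v
  Q-· true  v = refl
  Q-· false v = Q-zero

  B-sym : ∀ u v → B u v ≡ B v u
  B-sym u v = cong₂ _xor_ (cong Q (⊕-comm u v)) (xor-comm (Q u) (Q v))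

  B-self : ∀ v → B v v ≡ false
  B-self v = cong₂ _xor_ (trans (cong Q (⊕-self v)) Q-zero) (xor-same (Q v))

  B-𝟎ˡ : ∀ v → B 𝟎 v ≡ false
  B-𝟎ˡ v = trans (cong₂ (λ x q → Q x xor q xor Q v) (⊕-identityˡ v) Q-zero) (xor-same (Q v))

  B-·ˡ : ∀ b u v → B (b · u) v ≡ b ∧ B u v
  B-·ˡ true  u v = refl
  B-·ˡ false u v = B-𝟎ˡ v

  B-⊕ʳ : ∀ u v w → B u (v ⊕ w) ≡ B u v xor B u w
  B-⊕ʳ u v w = trans (B-sym u _) (trans (B-additiveˡ v w u) (cong₂ _xor_ (B-sym v u) (B-sym w u)))

  B-lcˡ : ∀ {k} (w : Fin k → V n) c u → B (lc w c) u ≡ sum (λ i → c i ∧ B (w i) u)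
  B-lcˡ {zero}  w c u = B-𝟎ˡ u
  B-lcˡ {suc k} w c u = trans (B-additiveˡ _ _ u)
    (cong₂ _xor_ (B-·ˡ (c zero) (w zero) u) (B-lcˡ (w ∘ suc) (c ∘ suc) u))

  Q-lc : ∀ {k} {w : Fin k → V n} {q G} → (∀ i → Q (w i) ≡ q i) → (∀ i j → B (w i) (w j) ≡ G i j) →
         ∀ c → Q (lc w c) ≡ quadratic q G c
  Q-lc {zero}              Qw≡q B≡G c = Q-zero
  Q-lc {suc k} {w} {q} {G} Qw≡q B≡G c = trans (Q-⊕ _ _)
    (cong₂ _xor_ first (cong₂ _xor_ (Q-lc (Qw≡q ∘ suc) (λ i j → B≡G (suc i) (suc j)) (c ∘ suc)) cross))
    where
    open ≡-Reasoning
    first : Q (c zero · w zero) ≡ c zero ∧ q zero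
    first = trans (Q-· (c zero) (w zero)) (cong (c zero ∧_) (Qw≡q zero))
    cross : B (c zero · w zero) (lc (w ∘ suc) (c ∘ suc)) ≡ c zero ∧ sum (λ j → c (suc j) ∧ G (suc j) zero)
    cross = trans (B-·ˡ (c zero) (w zero) _) (cong (c zero ∧_) (begin
      B (w zero) (lc (w ∘ suc) (c ∘ suc))             ≡⟨ B-sym _ _ ⟩
      B (lc (w ∘ suc) (c ∘ suc)) (w zero)             ≡⟨ B-lcˡ (w ∘ suc) (c ∘ suc) (w zero) ⟩
      sum (λ j → c (suc j) ∧ B (w (suc j)) (w zero)) ≡⟨ sum-cong-≗ (λ j → cong (c (suc j) ∧_) (B≡G (suc j) zero)) ⟩
      sum (λ j → c (suc j) ∧ G (suc j) zero)         ∎))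

  B-lc-lc : ∀ {k} {w : Fin k → V n} {G} → (∀ i j → B (w i) (w j) ≡ G i j) →
            ∀ c d → B (lc w c) (lc w d) ≡ bilinear G c d
  B-lc-lc {w = w} {G} B≡G c d = trans (B-lcˡ w c _) (sum-cong-≗ λ i → cong (c i ∧_) (begin
    B (w i) (lc w d)               ≡⟨ B-sym _ _ ⟩
    B (lc w d) (w i)               ≡⟨ B-lcˡ w d (w i) ⟩
    sum (λ j → d j ∧ B (w j) (w i)) ≡⟨ sum-cong-≗ (λ j → cong (d j ∧_) (B≡G j i)) ⟩
    sum (λ j → d j ∧ G j i)         ∎))
    where open ≡-Reasoning

  ⊥-lc : ∀ {k} {W : V n → Set} {w : Fin k → V n} → (∀ i → InPerp Q W (w i)) → ∀ c → InPerp Q W (lc w c)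
  ⊥-lc {w = w} w⊥W c u u∈W = begin
    B u (lc w c)                 ≡⟨ B-sym _ _ ⟩
    B (lc w c) u                 ≡⟨ B-lcˡ w c u ⟩
    sum (λ i → c i ∧ B (w i) u) ≡⟨ sum-false (λ i → trans (cong (c i ∧_) (trans (B-sym _ _) (w⊥W i u u∈W))) (∧-zeroʳ (c i))) ⟩
    false                        ∎
    where open ≡-Reasoning

  upper⇒nonorthogonal : ∀ {k} {w : Fin k → V n} → (∀ i j → i < j → B (w i) (w j) ≡ true) → Nonorthogonal w
  upper⇒nonorthogonal upper i j i≢j with <-cmp i j
  ... | tri< i<j _ _ = upper i j i<j
  ... | tri≈ _ i≡j _ = contradiction i≡j i≢j
  ... | tri> _ _ j<i = trans (B-sym _ _) (upper j i j<i)

  ++-nonorthogonal : ∀ {l k} {f : Fin l → V n} {u : Fin k → V n} → Nonorthogonal f → Nonorthogonal u →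
                     (∀ j i → B (f j) (u i) ≡ true) → Nonorthogonal (f ++ u)
  ++-nonorthogonal {l} {k} f-nonorth u-nonorth f-u p q p≢q with splitAt l p in p≡ | splitAt l q in q≡
  ... | inj₁ j | inj₁ j′ = f-nonorth j j′ λ j≡j′ →
    p≢q (trans (sym (splitAt⁻¹-↑ˡ p≡)) (trans (cong (_↑ˡ k) j≡j′) (splitAt⁻¹-↑ˡ q≡)))
  ... | inj₁ j | inj₂ i  = f-u j i
  ... | inj₂ i | inj₁ j  = trans (B-sym _ _) (f-u j i)
  ... | inj₂ i | inj₂ i′ = u-nonorth i i′ λ i≡i′ →
    p≢q (trans (sym (splitAt⁻¹-↑ʳ p≡)) (trans (cong (l ↑ʳ_) i≡i′) (splitAt⁻¹-↑ʳ q≡)))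

  nonorthogonal⇒independent : ∀ {k} {w : Fin k → V n} → 2 ∣ k → Nonorthogonal w → LinearlyIndependent w
  nonorthogonal⇒independent {k} {w} k-even w-nonorth c lc≡𝟎 j = trans (c≡Σc j) Σc≡false
    where
    c≡Σc : ∀ j → c j ≡ sum c
    c≡Σc j = sym (begin
      sum c                                 ≡⟨ sum-except j (trans (cong (c j ∧_) (B-self (w j))) (∧-zeroʳ (c j)))
                                                 (λ i i≢j → trans (cong (c i ∧_) (w-nonorth i j i≢j)) (∧-identityʳ (c i))) ⟩
      c j xor sum (λ i → c i ∧ B (w i) (w j)) ≡⟨ cong (c j xor_) (B-lcˡ w c (w j)) ⟨
      c j xor B (lc w c) (w j)              ≡⟨ cong (λ x → c j xor B x (w j)) lc≡𝟎 ⟩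
      c j xor B 𝟎 (w j)                     ≡⟨ cong (c j xor_) (B-𝟎ˡ (w j)) ⟩
      c j xor false                         ≡⟨ xor-identityʳ (c j) ⟩
      c j                                   ∎)
      where open ≡-Reasoning
    Σc≡false : sum c ≡ false
    Σc≡false = trans (sum-cong-≗ c≡Σc) (trans (sum-replicate k) (times-even (sum c) k-even))

  Q-sum-symmetric : ∀ {k} {v : Fin k → V n} → (∀ i → Q (v i) ≡ false) → (∀ i j → i < j → B (v i) (v j) ≡ true) →
                    Q (lc v (λ _ → true)) ≡ pairsParity k
  Q-sum-symmetric {zero}      Qv≡false upper = Q-zero
  Q-sum-symmetric {suc k} {v} Qv≡false upper = trans (Q-⊕ _ _) (cong₂ _xor_ (Qv≡false zero)
    (cong₂ _xor_ (Q-sum-symmetric (Qv≡false ∘ suc) (λ i j i<j → upper (suc i) (suc j) (s≤s i<j))) (begin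
      B (v zero) (lc (v ∘ suc) (λ _ → true))  ≡⟨ B-sym _ _ ⟩
      B (lc (v ∘ suc) (λ _ → true)) (v zero)  ≡⟨ B-lcˡ (v ∘ suc) _ (v zero) ⟩
      sum (λ j → B (v (suc j)) (v zero))      ≡⟨ sum-cong-≗ (λ j → trans (B-sym _ _) (upper zero (suc j) (s≤s z≤n))) ⟩
      sum {k} (λ _ → true)                    ≡⟨ sum-replicate k ⟩
      k times true                            ∎)))
    where open ≡-Reasoning

  B-sum-nonorthogonal : ∀ {k} {v : Fin k → V n} → 2 ∣ k → Nonorthogonal v → ∀ i → B (lc v (λ _ → true)) (v i) ≡ true
  B-sum-nonorthogonal {k} {v} k-even v-nonorth i = not-injective (begin
    not (B (lc v (λ _ → true)) (v i))        ≡⟨ cong not (B-lcˡ v _ (v i)) ⟩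
    not (sum (λ j → B (v j) (v i)))          ≡⟨ sum-except i (B-self (v i)) (λ j j≢i → v-nonorth j i j≢i) ⟨
    sum {k} (λ _ → true)                     ≡⟨ sum-replicate k ⟩
    k times true                             ≡⟨ times-even true k-even ⟩
    false                                    ∎)
    where open ≡-Reasoning

-- Extending a symmetric basis by an orthogonal nonorthogonal family

-- W +⟨ lookup (a ∷ b ∷ c ∷ d ∷ g ∷ h ∷ []) ⟩ unfolds to Extend3 W a b c d g h.
_+⟨_⟩ : ∀ {n l} → (V n → Set) → (Fin l → V n) → V n → Set
(W +⟨ y ⟩) x = ∃ λ w → W w × ∃ λ t → x ≡ w ⊕ lc y t

module Extension {n} {Q : V n → Bool} (isQ : IsQuadraticForm Q) {W : V n → Set}
  {k} {v : Fin k → V n} (v-symmetric : IsSymmetricBasis Q W v) (k%4≡2 : k % 4 ≡ 2)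
  {l} {y : Fin l → V n} (l-even : 2 ∣ l) (y-anisotropic : ∀ j → Q (y j) ≡ true)
  (y-nonorth : QuadraticForm.Nonorthogonal isQ y) (y⊥W : ∀ j → InPerp Q W (y j)) where

  open IsQuadraticForm isQ using (B-additiveˡ)
  open QuadraticForm isQ
  open ⊕-Properties {n} using (xy∙z≈zx∙y)

  private
    v-spans : Spans v W
    v-spans = proj₂ (proj₁ v-symmetric)

    v-isotropic : ∀ i → Q (v i) ≡ false
    v-isotropic = proj₁ (proj₂ v-symmetric)

    v-nonorth : Nonorthogonal v
    v-nonorth = upper⇒nonorthogonal (proj₂ (proj₂ v-symmetric))

  s : V n
  s = lc v (λ _ → true)

  private
    k-even : 2 ∣ k
    k-even = %4≡2⇒even {k} k%4≡2

    v∈W : ∀ i → W (v i)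
    v∈W i = subst W (lc-δ v i) (spans⇒lc∈ v-spans _)

    Q-s : Q s ≡ true
    Q-s = trans (Q-sum-symmetric v-isotropic (proj₂ (proj₂ v-symmetric))) (%4≡2⇒pairsParity {k} k%4≡2)

    B-s-v : ∀ i → B s (v i) ≡ true
    B-s-v = B-sum-nonorthogonal k-even v-nonorth

    B-s-y : ∀ j → B s (y j) ≡ false
    B-s-y j = y⊥W j s (spans⇒lc∈ v-spans _)

    B-y-v : ∀ j i → B (y j) (v i) ≡ false
    B-y-v j i = trans (B-sym _ _) (y⊥W j (v i) (v∈W i))

  z : Fin (l + k) → V n
  z = (λ j → s ⊕ y j) ++ v

  lc-z : ∀ c → lc z c ≡ lc v (λ i → c (l ↑ʳ i) xor sum (λ j → c (j ↑ˡ k))) ⊕ lc y (λ j → c (j ↑ˡ k))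
  lc-z c = begin
    lc z c
      ≡⟨ lc-++ _ v c ⟩
    lc (λ j → s ⊕ y j) t ⊕ lc v c′
      ≡⟨ cong (_⊕ lc v c′) (lc-shift s y t) ⟩
    (sum t · s ⊕ lc y t) ⊕ lc v c′
      ≡⟨ xy∙z≈zx∙y _ _ _ ⟩
    (lc v c′ ⊕ sum t · s) ⊕ lc y t
      ≡⟨ cong (λ x → (lc v c′ ⊕ x) ⊕ lc y t) (lc-· v _ (sum t)) ⟩
    (lc v c′ ⊕ lc v (λ _ → sum t)) ⊕ lc y t
      ≡⟨ cong (_⊕ lc y t) (lc-⊕ v c′ _) ⟩
    lc v (λ i → c′ i xor sum t) ⊕ lc y t ∎
    where
    open ≡-Reasoning
    t : Fin l → Bool
    t j = c (j ↑ˡ k)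
    c′ : Fin k → Bool
    c′ i = c (l ↑ʳ i)

  z-spans : Spans z (W +⟨ y ⟩)
  z-spans x = mk⇔ to from
    where
    from : (∃ λ c → lc z c ≡ x) → (W +⟨ y ⟩) x
    from (c , lc≡x) = _ , spans⇒lc∈ v-spans _ , _ , trans (sym lc≡x) (lc-z c)
    to : (W +⟨ y ⟩) x → ∃ λ c → lc z c ≡ x
    to (w , w∈W , t , x≡w⊕yt) with Equivalence.to (v-spans w) w∈W
    ... | c , lc≡w = t ++ c′ , (begin
      lc z (t ++ c′)                  ≡⟨ lc-z _ ⟩
      lc v _ ⊕ lc y _                 ≡⟨ cong₂ _⊕_ (lc-congʳ v c′-coeffs) (lc-congʳ y (lookup-++ˡ t c′)) ⟩
      lc v c ⊕ lc y t                 ≡⟨ cong (_⊕ lc y t) lc≡w ⟩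
      w ⊕ lc y t                      ≡⟨ x≡w⊕yt ⟨
      x                               ∎)
      where
      open ≡-Reasoning
      c′ : Fin k → Bool
      c′ i = c i xor sum t
      c′-coeffs : ∀ i → (t ++ c′) (l ↑ʳ i) xor sum (λ j → (t ++ c′) (j ↑ˡ k)) ≡ c i
      c′-coeffs i = begin
        (t ++ c′) (l ↑ʳ i) xor sum (λ j → (t ++ c′) (j ↑ˡ k)) ≡⟨ cong₂ _xor_ (lookup-++ʳ t c′ i) (sum-cong-≗ (lookup-++ˡ t c′)) ⟩
        (c i xor sum t) xor sum t                              ≡⟨ xor-assoc (c i) _ _ ⟩
        c i xor (sum t xor sum t)                              ≡⟨ cong (c i xor_) (xor-same (sum t)) ⟩
        c i xor false                                          ≡⟨ xor-identityʳ (c i) ⟩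
        c i                                                    ∎

  z-isotropic : ∀ p → Q (z p) ≡ false
  z-isotropic = ++⁺ (λ x → Q x ≡ false) shifted-isotropic v-isotropic
    where
    shifted-isotropic : ∀ j → Q (s ⊕ y j) ≡ false
    shifted-isotropic j = trans (Q-⊕ s (y j)) (cong₂ _xor_ Q-s (cong₂ _xor_ (y-anisotropic j) (B-s-y j)))

  z-nonorth : Nonorthogonal z
  z-nonorth = ++-nonorthogonal shifted-nonorth v-nonorth shifted-v
    where
    shifted-nonorth : Nonorthogonal (λ j → s ⊕ y j)
    shifted-nonorth i j i≢j = begin
      B (s ⊕ y i) (s ⊕ y j)                                   ≡⟨ B-additiveˡ s (y i) _ ⟩
      B s (s ⊕ y j) xor B (y i) (s ⊕ y j)                     ≡⟨ cong₂ _xor_ (B-⊕ʳ s s (y j)) (B-⊕ʳ (y i) s (y j)) ⟩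
      (B s s xor B s (y j)) xor (B (y i) s xor B (y i) (y j)) ≡⟨ cong₂ _xor_ (cong₂ _xor_ (B-self s) (B-s-y j))
                                                                   (cong₂ _xor_ (trans (B-sym _ _) (B-s-y i)) (y-nonorth i j i≢j)) ⟩
      true                                                    ∎
      where open ≡-Reasoning
    shifted-v : ∀ j i → B (s ⊕ y j) (v i) ≡ true
    shifted-v j i = trans (B-additiveˡ s (y j) (v i)) (cong₂ _xor_ (B-s-v i) (B-y-v j i))

  z-symmetric : IsSymmetricBasis Q (W +⟨ y ⟩) z
  z-symmetric = (nonorthogonal⇒independent (∣m∣n⇒∣m+n l-even k-even) z-nonorth , z-spans)
              , z-isotropic , λ i j i<j → z-nonorth i j (<⇒≢ i<j)

+⟨⟩-mono : ∀ {n k l} {W : V n → Set} {u : Fin k → V n} {w : Fin l → V n} →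
           (∀ i → ∃ λ c → lc w c ≡ u i) → ∀ {x} → (W +⟨ u ⟩) x → (W +⟨ w ⟩) x
+⟨⟩-mono {u = u} {w} u⊆⟨w⟩ (x₀ , x₀∈W , t , x≡x₀⊕ut) = x₀ , x₀∈W , _ , trans x≡x₀⊕ut (cong (x₀ ⊕_) (begin
  lc u t                                 ≡⟨ lc-congˡ (sym ∘ proj₂ ∘ u⊆⟨w⟩) t ⟩
  lc (λ i → lc w (proj₁ (u⊆⟨w⟩ i))) t   ≡⟨ lc-lc w (proj₁ ∘ u⊆⟨w⟩) t ⟩
  lc w _                                 ∎))
  where open ≡-Reasoning

IsSymmetricBasis-cong : ∀ {n k} {Q : V n → Bool} {A A′ : V n → Set} {w : Fin k → V n} →
                        (∀ x → A x ⇔ A′ x) → IsSymmetricBasis Q A w → IsSymmetricBasis Q A′ w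
IsSymmetricBasis-cong A⇔A′ ((w-indep , w-spans) , w-isotropic , w-upper) =
  (w-indep , λ x → ⇔.trans (⇔.sym (A⇔A′ x)) (w-spans x)) , w-isotropic , w-upper

-- Three orthogonal hyperbolic pairs

matrix₆ : Vec (Vec Bool 6) 6 → Fin 6 → Fin 6 → Bool
matrix₆ rows i j = lookup (lookup rows i) j

hyperbolic₆ : Fin 6 → Fin 6 → Bool
hyperbolic₆ = matrix₆
  ( (false ∷ true  ∷ false ∷ false ∷ false ∷ false ∷ [])
  ∷ (true  ∷ false ∷ false ∷ false ∷ false ∷ false ∷ [])
  ∷ (false ∷ false ∷ false ∷ true  ∷ false ∷ false ∷ [])
  ∷ (false ∷ false ∷ true  ∷ false ∷ false ∷ false ∷ [])
  ∷ (false ∷ false ∷ false ∷ false ∷ false ∷ true  ∷ [])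
  ∷ (false ∷ false ∷ false ∷ false ∷ true  ∷ false ∷ [])
  ∷ [])

-- In the basis a, b, c, d, g, h: the rows are a+c+d, b+c+d, c+g+h, d+g+h, g+a+b, h+a+b,
-- i.e. each vector of a pair plus the anisotropic vector of the next pair.
hexad : Fin 6 → Fin 6 → Bool
hexad = matrix₆
  ( (true  ∷ false ∷ true  ∷ true  ∷ false ∷ false ∷ [])
  ∷ (false ∷ true  ∷ true  ∷ true  ∷ false ∷ false ∷ [])
  ∷ (false ∷ false ∷ true  ∷ false ∷ true  ∷ true  ∷ [])
  ∷ (false ∷ false ∷ false ∷ true  ∷ true  ∷ true  ∷ [])
  ∷ (true  ∷ true  ∷ false ∷ false ∷ true  ∷ false ∷ [])
  ∷ (true  ∷ true  ∷ false ∷ false ∷ false ∷ true  ∷ [])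
  ∷ [])

hexad-anisotropic : ∀ j → quadratic (λ _ → false) hyperbolic₆ (hexad j) ≡ true
hexad-anisotropic = from-yes (all? λ j → quadratic (λ _ → false) hyperbolic₆ (hexad j) ≟ᵇ true)

hexad-nonorthogonal : ∀ i j → i ≢ j → bilinear hyperbolic₆ (hexad i) (hexad j) ≡ true
hexad-nonorthogonal = from-yes (all? λ i → all? λ j →
  ¬? (i ≟ j) →-dec bilinear hyperbolic₆ (hexad i) (hexad j) ≟ᵇ true)

hexad-involutive : ∀ l i → sum (λ j → hexad j i ∧ hexad l j) ≡ does (l ≟ i)
hexad-involutive = from-yes (all? λ l → all? λ i → sum (λ j → hexad j i ∧ hexad l j) ≟ᵇ does (l ≟ i))

module ThreeHyperbolicPairs {n} {Q : V n → Bool} (isQ : IsQuadraticForm Q) {a b c d g h : V n}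
  (ab : HyperbolicPair Q a b) (cd : HyperbolicPair Q c d) (gh : HyperbolicPair Q g h)
  (ab⊥cd : PairsPerp Q a b c d) (ab⊥gh : PairsPerp Q a b g h) (cd⊥gh : PairsPerp Q c d g h) where

  open QuadraticForm isQ

  E : Fin 6 → V n
  E = lookup (a ∷ b ∷ c ∷ d ∷ g ∷ h ∷ [])

  E-isotropic : ∀ i → Q (E i) ≡ false
  E-isotropic 0F = ab .proj₂ .proj₁
  E-isotropic 1F = ab .proj₂ .proj₂ .proj₁
  E-isotropic 2F = cd .proj₂ .proj₁
  E-isotropic 3F = cd .proj₂ .proj₂ .proj₁
  E-isotropic 4F = gh .proj₂ .proj₁
  E-isotropic 5F = gh .proj₂ .proj₂ .proj₁

  E-gram : ∀ i j → B (E i) (E j) ≡ hyperbolic₆ i j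
  E-gram 0F 0F = B-self a
  E-gram 0F 1F = ab .proj₂ .proj₂ .proj₂
  E-gram 0F 2F = ab⊥cd .proj₁
  E-gram 0F 3F = ab⊥cd .proj₂ .proj₁
  E-gram 0F 4F = ab⊥gh .proj₁
  E-gram 0F 5F = ab⊥gh .proj₂ .proj₁
  E-gram 1F 1F = B-self b
  E-gram 1F 2F = ab⊥cd .proj₂ .proj₂ .proj₁
  E-gram 1F 3F = ab⊥cd .proj₂ .proj₂ .proj₂
  E-gram 1F 4F = ab⊥gh .proj₂ .proj₂ .proj₁
  E-gram 1F 5F = ab⊥gh .proj₂ .proj₂ .proj₂
  E-gram 2F 2F = B-self c
  E-gram 2F 3F = cd .proj₂ .proj₂ .proj₂
  E-gram 2F 4F = cd⊥gh .proj₁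
  E-gram 2F 5F = cd⊥gh .proj₂ .proj₁
  E-gram 3F 3F = B-self d
  E-gram 3F 4F = cd⊥gh .proj₂ .proj₂ .proj₁
  E-gram 3F 5F = cd⊥gh .proj₂ .proj₂ .proj₂
  E-gram 4F 4F = B-self g
  E-gram 4F 5F = gh .proj₂ .proj₂ .proj₂
  E-gram 5F 5F = B-self h
  E-gram 1F 0F = trans (B-sym b a) (E-gram 0F 1F)
  E-gram 2F 0F = trans (B-sym c a) (E-gram 0F 2F)
  E-gram 3F 0F = trans (B-sym d a) (E-gram 0F 3F)
  E-gram 4F 0F = trans (B-sym g a) (E-gram 0F 4F)
  E-gram 5F 0F = trans (B-sym h a) (E-gram 0F 5F)
  E-gram 2F 1F = trans (B-sym c b) (E-gram 1F 2F)
  E-gram 3F 1F = trans (B-sym d b) (E-gram 1F 3F)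
  E-gram 4F 1F = trans (B-sym g b) (E-gram 1F 4F)
  E-gram 5F 1F = trans (B-sym h b) (E-gram 1F 5F)
  E-gram 3F 2F = trans (B-sym d c) (E-gram 2F 3F)
  E-gram 4F 2F = trans (B-sym g c) (E-gram 2F 4F)
  E-gram 5F 2F = trans (B-sym h c) (E-gram 2F 5F)
  E-gram 4F 3F = trans (B-sym g d) (E-gram 3F 4F)
  E-gram 5F 3F = trans (B-sym h d) (E-gram 3F 5F)
  E-gram 5F 4F = trans (B-sym h g) (E-gram 4F 5F)

  y : Fin 6 → V n
  y j = lc E (hexad j)

  y-anisotropic : ∀ j → Q (y j) ≡ true
  y-anisotropic j = trans (Q-lc E-isotropic E-gram (hexad j)) (hexad-anisotropic j)

  y-nonorth : Nonorthogonal y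
  y-nonorth i j i≢j = trans (B-lc-lc E-gram (hexad i) (hexad j)) (hexad-nonorthogonal i j i≢j)

  E∈⟨y⟩ : ∀ i → ∃ λ c → lc y c ≡ E i
  E∈⟨y⟩ i = hexad i , (begin
    lc y (hexad i)                                       ≡⟨ lc-lc E hexad (hexad i) ⟩
    lc E (λ l → sum (λ j → hexad j l ∧ hexad i j))      ≡⟨ lc-congʳ E (hexad-involutive i) ⟩
    lc E (λ l → does (i ≟ l))                           ≡⟨ lc-δ E i ⟩
    E i                                                  ∎)
    where open ≡-Reasoning

  y∈⟨E⟩ : ∀ j → ∃ λ c → lc E c ≡ y j
  y∈⟨E⟩ j = hexad j , refl

lemma3p2 : (r : ℕ) (Q : V (2 * r) → Bool) → IsQuadraticForm Q → Nondegenerate Q →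
    (W : V (2 * r) → Set) → IsSubspace W → Nontrivial W →
    (m : ℕ) → HasDimension W m → m % 4 ≡ 2 → HasSymmetricBasis Q W →
    (a b c d g h : V (2 * r)) →
    HyperbolicPair Q a b → HyperbolicPair Q c d → HyperbolicPair Q g h →
    (InPerp Q W a × ¬ W a) → (InPerp Q W b × ¬ W b) →
    (InPerp Q W c × ¬ W c) → (InPerp Q W d × ¬ W d) →
    (InPerp Q W g × ¬ W g) → (InPerp Q W h × ¬ W h) →
    PairsPerp Q a b c d → PairsPerp Q a b g h → PairsPerp Q c d g h →
    HasSymmetricBasis Q (Extend3 W a b c d g h)
lemma3p2 r Q isQ _ W _ _ m (_ , w-basis) m%4≡2 (k , v , v-symmetric) a b c d g h ab cd gh
  (a⊥W , _) (b⊥W , _) (c⊥W , _) (d⊥W , _) (g⊥W , _) (h⊥W , _) ab⊥cd ab⊥gh cd⊥gh =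
  6 + k , z , IsSymmetricBasis-cong {Q = Q} W+⟨y⟩⇔W+⟨E⟩ z-symmetric
  where
  open ThreeHyperbolicPairs isQ ab cd gh ab⊥cd ab⊥gh cd⊥gh
  open QuadraticForm isQ using (⊥-lc)

  k%4≡2 : k % 4 ≡ 2
  k%4≡2 = subst (λ k → k % 4 ≡ 2) (sym (basis-size-unique (proj₁ v-symmetric) w-basis)) m%4≡2

  E⊥W : ∀ i → InPerp Q W (E i)
  E⊥W 0F = a⊥W
  E⊥W 1F = b⊥W
  E⊥W 2F = c⊥W
  E⊥W 3F = d⊥W
  E⊥W 4F = g⊥W
  E⊥W 5F = h⊥W

  open Extension isQ v-symmetric k%4≡2 (divides 3 refl) y-anisotropic y-nonorth (λ j → ⊥-lc E⊥W (hexad j))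

  W+⟨y⟩⇔W+⟨E⟩ : ∀ x → (W +⟨ y ⟩) x ⇔ (W +⟨ E ⟩) x
  W+⟨y⟩⇔W+⟨E⟩ x = mk⇔ (+⟨⟩-mono {W = W} {y} {E} y∈⟨E⟩) (+⟨⟩-mono {W = W} {E} {y} E∈⟨y⟩)
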